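{- Let $p$ be a prime, $a\geq1$, and let $\tilde P$ be a Laurent polynomial in $x_1,\ldots,x_r$ satisfying $\tilde P(x_1,\ldots,x_r)^p\equiv\tilde P(x_1^p,\ldots,x_r^p)\pmod{p^a}$. If there exists $n_0\in\mathbb{N}$ such that $\mathrm{ct}(\tilde P^{n_0})\equiv0\pmod p$, then for every Laurent polynomial $Q$, the value $0$ has frequency $1$ in the sequence $\left(\mathrm{ct}(\tilde P^nQ)\bmod p^a\right)_{n\in\mathbb{N}}$.
   Context: $\mathrm{ct}(Q)$ denotes the constant term of a Laurent polynomial $Q$. Polynomials are taken with integer coefficients or coefficients in $\mathbb{Z}/p^a\mathbb{Z}$. The frequency of a value $c$ in $(s_n)$ is the asymptotic density of $\{n:s_n=c\}$. -}

module Defs where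

open import Data.Nat as ℕ using (ℕ; zero; suc)
open import Data.Integer as ℤ using (ℤ; +_)
open import Data.Integer.Divisibility using () renaming (_∣_ to _∣ℤ_)
open import Data.Nat.Divisibility using (_∣?_)
open import Data.List using (List; []; _∷_; map; concatMap; filter; length; upTo)
open import Data.Product using (_×_; _,_)
open import Data.Vec using (Vec; replicate; zipWith)
import Data.Vec as V
open import Data.Vec.Properties using (≡-dec)
open import Relation.Nullary using (¬?)

-- A Laurent polynomial in r variables with integer coefficients, given as a
-- finite formal sum of terms c·x^e (exponent vector e ∈ ℤ^r). Repeated
-- exponents are allowed; the actual coefficient is obtained by summing.
Monomial : ℕ → Set
Monomial r = Vec ℤ r × ℤ

LPoly : ℕ → Set
LPoly r = List (Monomial r)

coeff : ∀ {r} → LPoly r → Vec ℤ r → ℤ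
coeff [] e = + 0
coeff ((e' , c) ∷ P) e with ≡-dec ℤ._≟_ e' e
... | Relation.Nullary.yes _ = c ℤ.+ coeff P e
... | Relation.Nullary.no _ = coeff P e

ct : ∀ {r} → LPoly r → ℤ
ct {r} P = coeff P (replicate r (+ 0))

one : ∀ {r} → LPoly r
one {r} = (replicate r (+ 0) , + 1) ∷ []

_·_ : ∀ {r} → LPoly r → LPoly r → LPoly r
P · Q = concatMap (λ { (e , c) → map (λ { (e' , c') → (zipWith ℤ._+_ e e' , c ℤ.* c') }) Q }) P

_^ᴸ_ : ∀ {r} → LPoly r → ℕ → LPoly r
P ^ᴸ zero = one
P ^ᴸ suc n = P · (P ^ᴸ n)

frob : ∀ {r} → ℕ → LPoly r → LPoly r
frob p = map (λ { (e , c) → (V.map (λ z → + p ℤ.* z) e , c) })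

_≡[mod_]_ : ∀ {r} → LPoly r → ℕ → LPoly r → Set
P ≡[mod m ] Q = ∀ e → (+ m) ∣ℤ (coeff P e ℤ.- coeff Q e)

badCount : ℕ → (ℕ → ℤ) → ℕ → ℕ
badCount m s N = length (filter (λ n → ¬? (m ∣? ℤ.∣ s n ∣)) (upTo N))

-- the value 0 has frequency (asymptotic density) 1 in (s n mod m):
-- the density of {n : s n ≢ 0 mod m} is 0, i.e. for every k there is N₀
-- with k · #{n < N : s n ≢ 0 mod m} ≤ N for all N ≥ N₀.
ZeroFreqOne : ℕ → (ℕ → ℤ) → Set
ZeroFreqOne m s = ∀ (k : ℕ) → Data.Product.∃ λ N₀ → ∀ N → N₀ ℕ.≤ N → k ℕ.* badCount m s N ℕ.≤ N

-- Iterating P^p ≡ P(x^p) (mod p^a) gives P^(p^j·k) ≡ P(x^(p^j))^k.  So for n = p^j₁·m + p^j₂·n₀ + t,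
-- P^n·Q is congruent to the product of P(x^(p^j₁))^m, P(x^(p^j₂))^n₀ and P^t·Q.  When p^j₁ ≫ p^j₂ ≫ t
-- relative to the supports, a product of one monomial from each factor is constant only if all three
-- are, so ct(P^n Q) ≡ ct(P^m)·ct(P^n₀)·ct(P^t Q) (mod p^a), and p divides the middle factor.  Applying
-- this a times, p^a divides ct(P^n Q) whenever the base-b expansion of n contains one fixed digit d,
-- for a suitable power b of p.  Almost all n do: only (b-1)^M numbers below b^M avoid d.

module Submission where

open import Defs
open import Data.Nat using (ℕ; _≤_; _^_)
open import Data.Integer using (+_)
open import Data.Nat.Primality using (Prime; prime⇒nonZero; prime⇒nonTrivial)
open import Data.Integer.Divisibility using (_∣_)

open import Data.Nat as ℕ using (zero; suc; _+_; _*_; _∸_; _<_; z≤n; s≤s; NonZero; _≡ᵇ_)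
import Data.Nat.Properties as ℕₚ
import Data.Nat.Tactic.RingSolver as ℕ-solver
open import Data.Nat.DivMod using (_%_; _/_; m≡m%n+[m/n]*n; [m+kn]%n≡m%n; m<n⇒m%n≡m; m%n<n)
open import Data.Nat.Divisibility using () renaming (_∣_ to _∣ℕ_; _∣?_ to _∣ℕ?_)
import Data.Nat.Divisibility as ℕ-∣
open import Algebra.Properties.CommutativeSemigroup ℕₚ.+-commutativeSemigroup
  using () renaming (interchange to +-interchange)
open import Data.Integer as ℤ using (ℤ)
import Data.Integer.Properties as ℤₚ
open import Data.Integer.Tactic.RingSolver using (solve-∀)
open import Data.Integer.Divisibility.Signed as Signed using (divides) renaming (_∣_ to _∣ₛ_)
open import Algebra.Properties.CommutativeSemigroup ℤₚ.+-commutativeSemigroup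
  using () renaming (interchange to +-interchangeℤ)
open import Data.Bool using (Bool; true; false; not; _∧_; T)
open import Data.Vec as Vec using (Vec; []; _∷_; replicate; zipWith)
open import Data.Vec.Properties
  using (≡-dec; zipWith-comm; zipWith-assoc; zipWith-identityˡ; map-∘; map-cong; map-id; map-replicate)
open import Data.List using ([]; _∷_; _++_; map; length; filter; applyUpTo; upTo)
open import Data.List.Relation.Unary.All as All using (All; []; _∷_)
import Data.List.Relation.Unary.All.Properties as All
open import Data.Product using (∃; _×_; _,_; proj₁; proj₂)
open import Data.Empty using (⊥-elim)
open import Function using (_∘_)
open import Level using (0ℓ)
open import Relation.Binary.PropositionalEquality
open import Relation.Binary.Bundles using (Setoid)
import Relation.Binary.Reasoning.Setoid as SetoidReasoning
open import Relation.Nullary using (Dec; yes; no; ¬_; ¬?)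
open import Relation.Unary using (Pred; Decidable)

-- Exponent vectors

infixl 6 _⊕_ _⊖_

_⊕_ _⊖_ : ∀ {r} → Vec ℤ r → Vec ℤ r → Vec ℤ r
_⊕_ = zipWith ℤ._+_
_⊖_ = zipWith ℤ._-_

𝟘 : ∀ {r} → Vec ℤ r
𝟘 {r} = replicate r (+ 0)

scale : ∀ {r} → ℕ → Vec ℤ r → Vec ℤ r
scale N = Vec.map (+ N ℤ.*_)

⊕-comm : ∀ {r} (x y : Vec ℤ r) → x ⊕ y ≡ y ⊕ x
⊕-comm = zipWith-comm ℤₚ.+-comm

⊕-assoc : ∀ {r} (x y z : Vec ℤ r) → (x ⊕ y) ⊕ z ≡ x ⊕ (y ⊕ z)
⊕-assoc = zipWith-assoc ℤₚ.+-assoc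

⊕-identityˡ : ∀ {r} (x : Vec ℤ r) → 𝟘 ⊕ x ≡ x
⊕-identityˡ = zipWith-identityˡ ℤₚ.+-identityˡ

x⊕[y⊖x]≡y : ∀ {r} (x y : Vec ℤ r) → x ⊕ (y ⊖ x) ≡ y
x⊕[y⊖x]≡y [] [] = refl
x⊕[y⊖x]≡y (a ∷ x) (b ∷ y) = cong₂ _∷_ (lemma a b) (x⊕[y⊖x]≡y x y)
  where
  lemma : ∀ a b → a ℤ.+ (b ℤ.- a) ≡ b
  lemma = solve-∀

x⊕y≡z⇒y≡z⊖x : ∀ {r} (x y z : Vec ℤ r) → x ⊕ y ≡ z → y ≡ z ⊖ x
x⊕y≡z⇒y≡z⊖x x y _ refl = y≡[x⊕y]⊖x x y
  where
  y≡[x⊕y]⊖x : ∀ {r} (x y : Vec ℤ r) → y ≡ (x ⊕ y) ⊖ x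
  y≡[x⊕y]⊖x [] [] = refl
  y≡[x⊕y]⊖x (a ∷ x) (b ∷ y) = cong₂ _∷_ (lemma a b) (y≡[x⊕y]⊖x x y)
    where
    lemma : ∀ a b → b ≡ (a ℤ.+ b) ℤ.- a
    lemma = solve-∀

scale-⊕ : ∀ {r} N (x y : Vec ℤ r) → scale N (x ⊕ y) ≡ scale N x ⊕ scale N y
scale-⊕ N [] [] = refl
scale-⊕ N (a ∷ x) (b ∷ y) = cong₂ _∷_ (ℤₚ.*-distribˡ-+ (+ N) a b) (scale-⊕ N x y)

scale-𝟘 : ∀ {r} N → scale {r} N 𝟘 ≡ 𝟘
scale-𝟘 {r} N = trans (map-replicate (+ N ℤ.*_) (+ 0) r) (cong (replicate r) (ℤₚ.*-zeroʳ (+ N)))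

scale-1 : ∀ {r} (x : Vec ℤ r) → scale 1 x ≡ x
scale-1 x = trans (map-cong ℤₚ.*-identityˡ x) (map-id x)

scale-scale : ∀ {r} N M (x : Vec ℤ r) → scale N (scale M x) ≡ scale (N * M) x
scale-scale N M x = trans (sym (map-∘ (+ N ℤ.*_) (+ M ℤ.*_) x)) (map-cong assoc x)
  where
  assoc : ∀ z → + N ℤ.* (+ M ℤ.* z) ≡ + (N * M) ℤ.* z
  assoc z = trans (sym (ℤₚ.*-assoc (+ N) (+ M) z)) (cong (ℤ._* z) (sym (ℤₚ.pos-* N M)))

scale-injective : ∀ {r} N .{{_ : NonZero N}} (x y : Vec ℤ r) → scale N x ≡ scale N y → x ≡ y
scale-injective N [] [] _ = refl
scale-injective N (a ∷ x) (b ∷ y) eq =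
  cong₂ _∷_ (ℤₚ.*-cancelˡ-≡ (+ N) a b (cong Vec.head eq))
            (scale-injective N x y (cong Vec.tail eq))

‖_‖ : ∀ {r} → Vec ℤ r → ℕ
‖ [] ‖ = 0
‖ a ∷ x ‖ = ℤ.∣ a ∣ + ‖ x ‖

‖𝟘‖≡0 : ∀ {r} → ‖ 𝟘 {r} ‖ ≡ 0
‖𝟘‖≡0 {zero} = refl
‖𝟘‖≡0 {suc r} = ‖𝟘‖≡0 {r}

‖x‖≡0⇒x≡𝟘 : ∀ {r} (x : Vec ℤ r) → ‖ x ‖ ≡ 0 → x ≡ 𝟘
‖x‖≡0⇒x≡𝟘 [] _ = refl
‖x‖≡0⇒x≡𝟘 (a ∷ x) eq =
  cong₂ _∷_ (ℤₚ.∣i∣≡0⇒i≡0 (ℕₚ.m+n≡0⇒m≡0 _ eq)) (‖x‖≡0⇒x≡𝟘 x (ℕₚ.m+n≡0⇒n≡0 ℤ.∣ a ∣ eq))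

‖x⊕y‖≤‖x‖+‖y‖ : ∀ {r} (x y : Vec ℤ r) → ‖ x ⊕ y ‖ ≤ ‖ x ‖ + ‖ y ‖
‖x⊕y‖≤‖x‖+‖y‖ [] [] = z≤n
‖x⊕y‖≤‖x‖+‖y‖ (a ∷ x) (b ∷ y) = begin
  ℤ.∣ a ℤ.+ b ∣ + ‖ x ⊕ y ‖              ≤⟨ ℕₚ.+-mono-≤ (ℤₚ.∣i+j∣≤∣i∣+∣j∣ a b) (‖x⊕y‖≤‖x‖+‖y‖ x y) ⟩
  (ℤ.∣ a ∣ + ℤ.∣ b ∣) + (‖ x ‖ + ‖ y ‖)  ≡⟨ +-interchange ℤ.∣ a ∣ ℤ.∣ b ∣ ‖ x ‖ ‖ y ‖ ⟩
  (ℤ.∣ a ∣ + ‖ x ‖) + (ℤ.∣ b ∣ + ‖ y ‖)  ∎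
  where open ℕₚ.≤-Reasoning

‖scale‖ : ∀ {r} N (x : Vec ℤ r) → ‖ scale N x ‖ ≡ N * ‖ x ‖
‖scale‖ N [] = sym (ℕₚ.*-zeroʳ N)
‖scale‖ N (a ∷ x) = trans (cong₂ _+_ (ℤₚ.abs-* (+ N) a) (‖scale‖ N x)) (sym (ℕₚ.*-distribˡ-+ N _ _))

x⊕y≡𝟘⇒‖x‖≡‖y‖ : ∀ {r} (x y : Vec ℤ r) → x ⊕ y ≡ 𝟘 → ‖ x ‖ ≡ ‖ y ‖
x⊕y≡𝟘⇒‖x‖≡‖y‖ [] [] _ = refl
x⊕y≡𝟘⇒‖x‖≡‖y‖ (a ∷ x) (b ∷ y) eq =
  cong₂ _+_ (a+b≡0⇒∣a∣≡∣b∣ (cong Vec.head eq)) (x⊕y≡𝟘⇒‖x‖≡‖y‖ x y (cong Vec.tail eq))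
  where
  a+b≡0⇒∣a∣≡∣b∣ : a ℤ.+ b ≡ + 0 → ℤ.∣ a ∣ ≡ ℤ.∣ b ∣
  a+b≡0⇒∣a∣≡∣b∣ a+b≡0 = trans (sym (ℤₚ.∣-i∣≡∣i∣ a)) (cong ℤ.∣_∣ (sym b≡-a))
    where
    b≡[a+b]-a : ∀ a b → b ≡ (a ℤ.+ b) ℤ.- a
    b≡[a+b]-a = solve-∀
    b≡-a : b ≡ ℤ.- a
    b≡-a = trans (b≡[a+b]-a a b) (trans (cong (ℤ._- a) a+b≡0) (ℤₚ.+-identityˡ (ℤ.- a)))

scale⊕small≡𝟘⇒𝟘 : ∀ {r} N (u w : Vec ℤ r) → ‖ w ‖ < N → scale N u ⊕ w ≡ 𝟘 → u ≡ 𝟘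
scale⊕small≡𝟘⇒𝟘 N u w ‖w‖<N eq with ‖ u ‖ in ‖u‖≡
... | zero = ‖x‖≡0⇒x≡𝟘 u ‖u‖≡
... | suc k = ⊥-elim (ℕₚ.<⇒≱ ‖w‖<N (begin
  N                  ≤⟨ ℕₚ.m≤m*n N (suc k) ⟩
  N * suc k          ≡⟨ sym (trans (‖scale‖ N u) (cong (N *_) ‖u‖≡)) ⟩
  ‖ scale N u ‖      ≡⟨ x⊕y≡𝟘⇒‖x‖≡‖y‖ (scale N u) w eq ⟩
  ‖ w ‖              ∎))
  where open ℕₚ.≤-Reasoning

-- Laurent polynomials as finite sums

δ : ∀ {r} → Vec ℤ r → Vec ℤ r → ℤ
δ e x with ≡-dec ℤ._≟_ x e
... | yes _ = + 1
... | no _ = + 0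

δ-≢ : ∀ {r} {e x : Vec ℤ r} → x ≢ e → δ e x ≡ + 0
δ-≢ {e = e} {x} x≢e with ≡-dec ℤ._≟_ x e
... | yes x≡e = ⊥-elim (x≢e x≡e)
... | no _ = refl

δ-⊕ : ∀ {r} (e x y : Vec ℤ r) → δ e (x ⊕ y) ≡ δ (e ⊖ x) y
δ-⊕ e x y with ≡-dec ℤ._≟_ (x ⊕ y) e | ≡-dec ℤ._≟_ y (e ⊖ x)
... | yes _ | yes _ = refl
... | no _ | no _ = refl
... | yes x⊕y≡e | no y≢e⊖x = ⊥-elim (y≢e⊖x (x⊕y≡z⇒y≡z⊖x x y e x⊕y≡e))
... | no x⊕y≢e | yes refl = ⊥-elim (x⊕y≢e (x⊕[y⊖x]≡y x e))

δ-scale : ∀ {r} N .{{_ : NonZero N}} (e x : Vec ℤ r) → δ (scale N e) (scale N x) ≡ δ e x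
δ-scale N e x with ≡-dec ℤ._≟_ (scale N x) (scale N e) | ≡-dec ℤ._≟_ x e
... | yes _ | yes _ = refl
... | no _ | no _ = refl
... | yes Nx≡Ne | no x≢e = ⊥-elim (x≢e (scale-injective N x e Nx≡Ne))
... | no Nx≢Ne | yes refl = ⊥-elim (Nx≢Ne refl)

δ𝟘-scale⊕small : ∀ {r} N (u w : Vec ℤ r) → ‖ w ‖ < N → δ 𝟘 (scale N u ⊕ w) ≡ δ 𝟘 u ℤ.* δ 𝟘 w
δ𝟘-scale⊕small N u w ‖w‖<N with ≡-dec ℤ._≟_ u 𝟘
... | yes refl = trans (cong (δ 𝟘) (trans (cong (_⊕ w) (scale-𝟘 N)) (⊕-identityˡ w)))
                       (sym (ℤₚ.*-identityˡ (δ 𝟘 w)))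
... | no u≢𝟘 = δ-≢ (λ Nu⊕w≡𝟘 → u≢𝟘 (scale⊕small≡𝟘⇒𝟘 N u w ‖w‖<N Nu⊕w≡𝟘))

pair : ∀ {r} → LPoly r → (Vec ℤ r → ℤ) → ℤ
pair [] F = + 0
pair ((e , c) ∷ P) F = c ℤ.* F e ℤ.+ pair P F

coeff≡pair-δ : ∀ {r} (P : LPoly r) e → coeff P e ≡ pair P (δ e)
coeff≡pair-δ [] e = refl
coeff≡pair-δ ((e' , c) ∷ P) e with ≡-dec ℤ._≟_ e' e
... | yes _ = cong₂ ℤ._+_ (sym (ℤₚ.*-identityʳ c)) (coeff≡pair-δ P e)
... | no _ = trans (coeff≡pair-δ P e) (sym (trans (cong (ℤ._+ pair P (δ e)) (ℤₚ.*-zeroʳ c)) (ℤₚ.+-identityˡ _)))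

pair-cong : ∀ {r} (P : LPoly r) {F G : Vec ℤ r → ℤ} → (∀ e → F e ≡ G e) → pair P F ≡ pair P G
pair-cong [] F≗G = refl
pair-cong ((e , c) ∷ P) F≗G = cong₂ ℤ._+_ (cong (c ℤ.*_) (F≗G e)) (pair-cong P F≗G)

pair-cong-on : ∀ {r} {Pr : Vec ℤ r → Set} (P : LPoly r) {F G : Vec ℤ r → ℤ} →
               All (Pr ∘ proj₁) P → (∀ e → Pr e → F e ≡ G e) → pair P F ≡ pair P G
pair-cong-on [] _ F≗G = refl
pair-cong-on ((e , c) ∷ P) (Pr-e ∷ Pr-P) F≗G = cong₂ ℤ._+_ (cong (c ℤ.*_) (F≗G e Pr-e)) (pair-cong-on P Pr-P F≗G)

pair-++ : ∀ {r} (P Q : LPoly r) F → pair (P ++ Q) F ≡ pair P F ℤ.+ pair Q F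
pair-++ [] Q F = sym (ℤₚ.+-identityˡ _)
pair-++ ((e , c) ∷ P) Q F = trans (cong (λ X → c ℤ.* F e ℤ.+ X) (pair-++ P Q F)) (sym (ℤₚ.+-assoc (c ℤ.* F e) _ _))

pair-+ : ∀ {r} (P : LPoly r) F G → pair P (λ e → F e ℤ.+ G e) ≡ pair P F ℤ.+ pair P G
pair-+ [] F G = refl
pair-+ ((e , c) ∷ P) F G =
  trans (cong₂ ℤ._+_ (ℤₚ.*-distribˡ-+ c (F e) (G e)) (pair-+ P F G))
        (+-interchangeℤ (c ℤ.* F e) (c ℤ.* G e) (pair P F) (pair P G))

pair-- : ∀ {r} (P : LPoly r) F G → pair P (λ e → F e ℤ.- G e) ≡ pair P F ℤ.- pair P G
pair-- [] F G = refl
pair-- ((e , c) ∷ P) F G = trans (cong (λ X → c ℤ.* (F e ℤ.- G e) ℤ.+ X) (pair-- P F G)) (lemma c (F e) (G e) (pair P F) (pair P G))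
  where
  lemma : ∀ c f g X Y → c ℤ.* (f ℤ.- g) ℤ.+ (X ℤ.- Y) ≡ (c ℤ.* f ℤ.+ X) ℤ.- (c ℤ.* g ℤ.+ Y)
  lemma = solve-∀

pair-*ˡ : ∀ {r} (P : LPoly r) k F → pair P (λ e → k ℤ.* F e) ≡ k ℤ.* pair P F
pair-*ˡ [] k F = sym (ℤₚ.*-zeroʳ k)
pair-*ˡ ((e , c) ∷ P) k F = trans (cong₂ ℤ._+_ (lemma c k (F e)) (pair-*ˡ P k F)) (sym (ℤₚ.*-distribˡ-+ k _ _))
  where
  lemma : ∀ c k f → c ℤ.* (k ℤ.* f) ≡ k ℤ.* (c ℤ.* f)
  lemma = solve-∀

pair-*ʳ : ∀ {r} (P : LPoly r) k F → pair P (λ e → F e ℤ.* k) ≡ pair P F ℤ.* k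
pair-*ʳ P k F = trans (pair-cong P (λ e → ℤₚ.*-comm (F e) k)) (trans (pair-*ˡ P k F) (ℤₚ.*-comm k _))

pair-0 : ∀ {r} (P : LPoly r) → pair P (λ _ → + 0) ≡ + 0
pair-0 P = pair-*ˡ P (+ 0) (λ _ → + 0)

pair-swap : ∀ {r s} (P : LPoly r) (Q : LPoly s) (G : Vec ℤ r → Vec ℤ s → ℤ) →
            pair P (λ x → pair Q (G x)) ≡ pair Q (λ y → pair P (λ x → G x y))
pair-swap [] Q G = sym (pair-0 Q)
pair-swap ((e , c) ∷ P) Q G = begin
  c ℤ.* pair Q (G e) ℤ.+ pair P (λ x → pair Q (G x))
    ≡⟨ cong₂ ℤ._+_ (sym (pair-*ˡ Q c (G e))) (pair-swap P Q G) ⟩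
  pair Q (λ y → c ℤ.* G e y) ℤ.+ pair Q (λ y → pair P (λ x → G x y))
    ≡⟨ sym (pair-+ Q _ _) ⟩
  pair Q (λ y → c ℤ.* G e y ℤ.+ pair P (λ x → G x y)) ∎
  where open ≡-Reasoning

pair-∣ : ∀ {r} {k} (P : LPoly r) F → (∀ e → k ∣ₛ F e) → k ∣ₛ pair P F
pair-∣ [] F k∣F = divides (+ 0) refl
pair-∣ ((e , c) ∷ P) F k∣F = Signed.∣m∣n⇒∣m+n (Signed.∣n⇒∣m*n c (k∣F e)) (pair-∣ P F k∣F)

-- The maps inside _·_ and frob are pattern lambdas, to which no other term is definitionally
-- equal; lemmas about them therefore take the map and its defining equation as arguments.
private
  pair-map-shift : ∀ {r} (h : Monomial r → Monomial r) (Q : LPoly r) F c e →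
                   (∀ e' c' → h (e' , c') ≡ (e ⊕ e' , c ℤ.* c')) →
                   pair (map h Q) F ≡ c ℤ.* pair Q (λ y → F (e ⊕ y))
  pair-map-shift h [] F c e h≡ = sym (ℤₚ.*-zeroʳ c)
  pair-map-shift h ((e' , c') ∷ Q) F c e h≡ rewrite h≡ e' c' =
    trans (cong₂ ℤ._+_ (ℤₚ.*-assoc c c' _) (pair-map-shift h Q F c e h≡)) (sym (ℤₚ.*-distribˡ-+ c _ _))

  pair-map-scale : ∀ {r} (h : Monomial r → Monomial r) N (Q : LPoly r) F →
                   (∀ e' c' → h (e' , c') ≡ (scale N e' , c')) →
                   pair (map h Q) F ≡ pair Q (F ∘ scale N)
  pair-map-scale h N [] F h≡ = refl
  pair-map-scale h N ((e' , c') ∷ Q) F h≡ rewrite h≡ e' c' =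
    cong (λ X → c' ℤ.* F (scale N e') ℤ.+ X) (pair-map-scale h N Q F h≡)

pair-· : ∀ {r} (P Q : LPoly r) F → pair (P · Q) F ≡ pair P (λ x → pair Q (λ y → F (x ⊕ y)))
pair-· [] Q F = refl
pair-· ((e , c) ∷ P) Q F =
  trans (pair-++ (map _ Q) (P · Q) F) (cong₂ ℤ._+_ (pair-map-shift _ Q F c e (λ _ _ → refl)) (pair-· P Q F))

pair-frob : ∀ {r} N (Q : LPoly r) F → pair (frob N Q) F ≡ pair Q (F ∘ scale N)
pair-frob N Q F = pair-map-scale _ N Q F (λ _ _ → refl)

pair-one : ∀ {r} F → pair (one {r}) F ≡ F 𝟘
pair-one F = trans (ℤₚ.+-identityʳ _) (ℤₚ.*-identityˡ _)

coeff-·-pair : ∀ {r} (A B : LPoly r) e → coeff (A · B) e ≡ pair A (λ x → pair B (λ y → δ e (x ⊕ y)))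
coeff-·-pair A B e = trans (coeff≡pair-δ (A · B) e) (pair-· A B (δ e))

coeff-· : ∀ {r} (A B : LPoly r) e → coeff (A · B) e ≡ pair A (λ x → coeff B (e ⊖ x))
coeff-· A B e = trans (coeff-·-pair A B e)
  (pair-cong A (λ x → trans (pair-cong B (δ-⊕ e x)) (sym (coeff≡pair-δ B (e ⊖ x)))))

coeff-frob-pair : ∀ {r} N (A : LPoly r) e → coeff (frob N A) e ≡ pair A (δ e ∘ scale N)
coeff-frob-pair N A e = trans (coeff≡pair-δ (frob N A) e) (pair-frob N A (δ e))

-- Congruence modulo m

infix 4 _≈_[mod_]

record _≈_[mod_] {r} (A B : LPoly r) (m : ℕ) : Set where
  constructor coeffwise
  field coeff-∣ : ∀ e → + m ∣ₛ coeff A e ℤ.- coeff B e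
open _≈_[mod_] public

∣ₛ-subst : ∀ {k x y} → x ≡ y → k ∣ₛ x → k ∣ₛ y
∣ₛ-subst refl k∣x = k∣x

∣ₛ0 : ∀ {k} → k ∣ₛ + 0
∣ₛ0 {k} = divides (+ 0) (sym (ℤₚ.*-zeroˡ k))

1∣ₛ : ∀ x → + 1 ∣ₛ x
1∣ₛ x = divides x (sym (ℤₚ.*-identityʳ x))

-- Exact identities are stated as congruences modulo an arbitrary m, the only form in which they are used.
coeff-≡⇒≈ : ∀ {r m} {A B : LPoly r} → (∀ e → coeff A e ≡ coeff B e) → A ≈ B [mod m ]
coeff-≡⇒≈ {A = A} {B} A≗B = coeffwise λ e →
  ∣ₛ-subst (sym (trans (cong (ℤ._- coeff B e) (A≗B e)) (ℤₚ.+-inverseʳ (coeff B e)))) ∣ₛ0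

≈-refl : ∀ {r m} {A : LPoly r} → A ≈ A [mod m ]
≈-refl = coeff-≡⇒≈ λ _ → refl

≈-sym : ∀ {r m} {A B : LPoly r} → A ≈ B [mod m ] → B ≈ A [mod m ]
≈-sym {A = A} {B} A≈B = coeffwise λ e →
  ∣ₛ-subst (lemma (coeff A e) (coeff B e)) (Signed.∣m⇒∣-m (coeff-∣ A≈B e))
  where
  lemma : ∀ a b → ℤ.- (a ℤ.- b) ≡ b ℤ.- a
  lemma = solve-∀

≈-trans : ∀ {r m} {A B C : LPoly r} → A ≈ B [mod m ] → B ≈ C [mod m ] → A ≈ C [mod m ]
≈-trans {A = A} {B} {C} A≈B B≈C = coeffwise λ e →
  ∣ₛ-subst (lemma (coeff A e) (coeff B e) (coeff C e)) (Signed.∣m∣n⇒∣m+n (coeff-∣ A≈B e) (coeff-∣ B≈C e))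
  where
  lemma : ∀ a b c → (a ℤ.- b) ℤ.+ (b ℤ.- c) ≡ a ℤ.- c
  lemma = solve-∀

≈-setoid : ℕ → ℕ → Setoid 0ℓ 0ℓ
≈-setoid r m = record
  { Carrier = LPoly r
  ; _≈_ = _≈_[mod m ]
  ; isEquivalence = record { refl = ≈-refl ; sym = ≈-sym ; trans = ≈-trans }
  }

module ≈-Reasoning {r} (m : ℕ) = SetoidReasoning (≈-setoid r m)

·-comm : ∀ {r m} (A B : LPoly r) → A · B ≈ B · A [mod m ]
·-comm A B = coeff-≡⇒≈ λ e → begin
  coeff (A · B) e                                    ≡⟨ coeff-·-pair A B e ⟩
  pair A (λ x → pair B (λ y → δ e (x ⊕ y)))          ≡⟨ pair-swap A B _ ⟩
  pair B (λ y → pair A (λ x → δ e (x ⊕ y)))          ≡⟨ pair-cong B (λ y → pair-cong A (λ x → cong (δ e) (⊕-comm x y))) ⟩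
  pair B (λ y → pair A (λ x → δ e (y ⊕ x)))          ≡⟨ coeff-·-pair B A e ⟨
  coeff (B · A) e                                    ∎
  where open ≡-Reasoning

·-assoc : ∀ {r m} (A B C : LPoly r) → (A · B) · C ≈ A · (B · C) [mod m ]
·-assoc A B C = coeff-≡⇒≈ λ e → begin
  coeff ((A · B) · C) e                                             ≡⟨ coeff-·-pair (A · B) C e ⟩
  pair (A · B) (λ xy → pair C (λ z → δ e (xy ⊕ z)))                 ≡⟨ pair-· A B _ ⟩
  pair A (λ x → pair B (λ y → pair C (λ z → δ e ((x ⊕ y) ⊕ z))))    ≡⟨ pair-cong A (λ x → pair-cong B (λ y → pair-cong C (λ z → cong (δ e) (⊕-assoc x y z)))) ⟩
  pair A (λ x → pair B (λ y → pair C (λ z → δ e (x ⊕ (y ⊕ z)))))    ≡⟨ pair-cong A (λ x → pair-· B C _) ⟨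
  pair A (λ x → pair (B · C) (λ yz → δ e (x ⊕ yz)))                 ≡⟨ coeff-·-pair A (B · C) e ⟨
  coeff (A · (B · C)) e                                             ∎
  where open ≡-Reasoning

·-identityˡ : ∀ {r m} (A : LPoly r) → one · A ≈ A [mod m ]
·-identityˡ {r} A = coeff-≡⇒≈ λ e → begin
  coeff (one · A) e                            ≡⟨ coeff-·-pair one A e ⟩
  pair one (λ x → pair A (λ y → δ e (x ⊕ y)))  ≡⟨ pair-one {r} (λ x → pair A (λ y → δ e (x ⊕ y))) ⟩
  pair A (λ y → δ e (𝟘 ⊕ y))                   ≡⟨ pair-cong A (λ y → cong (δ e) (⊕-identityˡ y)) ⟩
  pair A (δ e)                                 ≡⟨ coeff≡pair-δ A e ⟨
  coeff A e                                    ∎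
  where open ≡-Reasoning

·-identityʳ : ∀ {r m} (A : LPoly r) → A · one ≈ A [mod m ]
·-identityʳ A = ≈-trans (·-comm A one) (·-identityˡ A)

·-congˡ : ∀ {r m} (A : LPoly r) {B B′} → B ≈ B′ [mod m ] → A · B ≈ A · B′ [mod m ]
·-congˡ {m = m} A {B} {B′} B≈B′ = coeffwise λ e →
  ∣ₛ-subst (trans (pair-- A _ _) (sym (cong₂ ℤ._-_ (coeff-· A B e) (coeff-· A B′ e))))
           (pair-∣ A _ (λ x → coeff-∣ B≈B′ (e ⊖ x)))

·-congʳ : ∀ {r m} {A A′} (B : LPoly r) → A ≈ A′ [mod m ] → A · B ≈ A′ · B [mod m ]
·-congʳ {A = A} {A′} B A≈A′ = ≈-trans (·-comm A B) (≈-trans (·-congˡ B A≈A′) (·-comm B A′))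

·-cong : ∀ {r m} {A A′ B B′ : LPoly r} → A ≈ A′ [mod m ] → B ≈ B′ [mod m ] → A · B ≈ A′ · B′ [mod m ]
·-cong {A′ = A′} {B = B} A≈A′ B≈B′ = ≈-trans (·-congʳ B A≈A′) (·-congˡ A′ B≈B′)

∣ₛ-* : ∀ {a b x y} → a ∣ₛ x → b ∣ₛ y → a ℤ.* b ∣ₛ x ℤ.* y
∣ₛ-* {a} {y = y} a∣x b∣y = Signed.∣-trans (Signed.*-monoʳ-∣ a b∣y) (Signed.*-monoˡ-∣ y a∣x)

≈⇒ct-∣ : ∀ {r m} {A B : LPoly r} → A ≈ B [mod m ] → + m ∣ₛ ct A → + m ∣ₛ ct B
≈⇒ct-∣ {A = A} {B} A≈B m∣ctA = ∣ₛ-subst (lemma (ct A) (ct B)) (Signed.∣m∣n⇒∣m-n m∣ctA (coeff-∣ A≈B 𝟘))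
  where
  lemma : ∀ a b → a ℤ.- (a ℤ.- b) ≡ b
  lemma = solve-∀

^-+ : ∀ {r m} (P : LPoly r) a b → P ^ᴸ (a + b) ≈ (P ^ᴸ a) · (P ^ᴸ b) [mod m ]
^-+ P zero b = ≈-sym (·-identityˡ (P ^ᴸ b))
^-+ P (suc a) b = ≈-trans (·-congˡ P (^-+ P a b)) (≈-sym (·-assoc P (P ^ᴸ a) (P ^ᴸ b)))

^-* : ∀ {r m} (P : LPoly r) a b → P ^ᴸ (a * b) ≈ (P ^ᴸ a) ^ᴸ b [mod m ]
^-* P a zero rewrite ℕₚ.*-zeroʳ a = ≈-refl
^-* P a (suc b) rewrite ℕₚ.*-suc a b = ≈-trans (^-+ P a (a * b)) (·-congˡ (P ^ᴸ a) (^-* P a b))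

^-cong : ∀ {r m} {A B : LPoly r} n → A ≈ B [mod m ] → A ^ᴸ n ≈ B ^ᴸ n [mod m ]
^-cong zero A≈B = ≈-refl
^-cong (suc n) A≈B = ·-cong A≈B (^-cong n A≈B)

-- Frobenius

frob-· : ∀ {r m} N (A B : LPoly r) → frob N (A · B) ≈ frob N A · frob N B [mod m ]
frob-· N A B = coeff-≡⇒≈ λ e → begin
  coeff (frob N (A · B)) e                                          ≡⟨ coeff-frob-pair N (A · B) e ⟩
  pair (A · B) (δ e ∘ scale N)                                      ≡⟨ pair-· A B _ ⟩
  pair A (λ x → pair B (λ y → δ e (scale N (x ⊕ y))))               ≡⟨ pair-cong A (λ x → pair-cong B (λ y → cong (δ e) (scale-⊕ N x y))) ⟩
  pair A (λ x → pair B (λ y → δ e (scale N x ⊕ scale N y)))         ≡⟨ pair-cong A (λ x → pair-frob N B _) ⟨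
  pair A (λ x → pair (frob N B) (λ y → δ e (scale N x ⊕ y)))        ≡⟨ pair-frob N A _ ⟨
  pair (frob N A) (λ x → pair (frob N B) (λ y → δ e (x ⊕ y)))       ≡⟨ coeff-·-pair (frob N A) (frob N B) e ⟨
  coeff (frob N A · frob N B) e                                     ∎
  where open ≡-Reasoning

frob-one : ∀ {r m} N → frob N (one {r}) ≈ one [mod m ]
frob-one {r} N = coeff-≡⇒≈ λ e → begin
  coeff (frob N one) e      ≡⟨ coeff-frob-pair N one e ⟩
  pair one (δ e ∘ scale N)  ≡⟨ pair-one {r} (δ e ∘ scale N) ⟩
  δ e (scale N 𝟘)           ≡⟨ cong (δ e) (scale-𝟘 N) ⟩
  δ e 𝟘                     ≡⟨ pair-one {r} (δ e) ⟨
  pair one (δ e)            ≡⟨ coeff≡pair-δ one e ⟨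
  coeff one e               ∎
  where open ≡-Reasoning

frob-^ : ∀ {r m} N (A : LPoly r) n → frob N (A ^ᴸ n) ≈ (frob N A) ^ᴸ n [mod m ]
frob-^ N A zero = frob-one N
frob-^ N A (suc n) = ≈-trans (frob-· N A (A ^ᴸ n)) (·-congˡ (frob N A) (frob-^ N A n))

frob-frob : ∀ {r m} N M (A : LPoly r) → frob N (frob M A) ≈ frob (N * M) A [mod m ]
frob-frob N M A = coeff-≡⇒≈ λ e → trans (coeff-frob-pair N (frob M A) e)
  (trans (pair-frob M A _) (trans (pair-cong A (λ x → cong (δ e) (scale-scale N M x))) (sym (coeff-frob-pair (N * M) A e))))

frob-1 : ∀ {r m} (A : LPoly r) → frob 1 A ≈ A [mod m ]
frob-1 A = coeff-≡⇒≈ λ e → trans (coeff-frob-pair 1 A e)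
  (trans (pair-cong A (λ x → cong (δ e) (scale-1 x))) (sym (coeff≡pair-δ A e)))

scale-image? : ∀ {r} N (e : Vec ℤ r) → Dec (∃ λ u → scale N u ≡ e)
scale-image? N [] = yes ([] , refl)
scale-image? N (c ∷ e) with + N Signed.∣? c | scale-image? N e
... | yes (divides q c≡qN) | yes (u , refl) = yes (q ∷ u , cong (_∷ scale N u) (trans (ℤₚ.*-comm (+ N) q) (sym c≡qN)))
... | yes _ | no ∄u = no λ { (_ ∷ u , eq) → ∄u (u , cong Vec.tail eq) }
... | no N∤c | _ = no λ { (z ∷ _ , eq) → N∤c (divides z (trans (sym (cong Vec.head eq)) (ℤₚ.*-comm (+ N) z))) }

coeff-frob-scale : ∀ {r} N .{{_ : NonZero N}} (A : LPoly r) u → coeff (frob N A) (scale N u) ≡ coeff A u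
coeff-frob-scale N A u = trans (coeff-frob-pair N A (scale N u)) (trans (pair-cong A (δ-scale N u)) (sym (coeff≡pair-δ A u)))

coeff-frob-∉image : ∀ {r} N (A : LPoly r) e → ¬ (∃ λ u → scale N u ≡ e) → coeff (frob N A) e ≡ + 0
coeff-frob-∉image N A e ∄u = trans (coeff-frob-pair N A e)
  (trans (pair-cong A (λ x → δ-≢ λ Nx≡e → ∄u (x , Nx≡e))) (pair-0 A))

frob-cong : ∀ {r m} N .{{_ : NonZero N}} {A B : LPoly r} → A ≈ B [mod m ] → frob N A ≈ frob N B [mod m ]
frob-cong {m = m} N {A} {B} A≈B = coeffwise λ e → helper e (scale-image? N e)
  where
  helper : ∀ e → Dec (∃ λ u → scale N u ≡ e) → + m ∣ₛ coeff (frob N A) e ℤ.- coeff (frob N B) e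
  helper _ (yes (u , refl)) = ∣ₛ-subst (sym (cong₂ ℤ._-_ (coeff-frob-scale N A u) (coeff-frob-scale N B u))) (coeff-∣ A≈B u)
  helper e (no ∄u) = ∣ₛ-subst (sym (cong₂ ℤ._-_ (coeff-frob-∉image N A e ∄u) (coeff-frob-∉image N B e ∄u))) ∣ₛ0

module _ {r m N} .{{_ : NonZero N}} {P : LPoly r} (P^N≈frob : P ^ᴸ N ≈ frob N P [mod m ]) where

  ^-N^j≈frob : ∀ j → P ^ᴸ (N ^ j) ≈ frob (N ^ j) P [mod m ]
  ^-N^j≈frob zero = ≈-trans (·-identityʳ P) (≈-sym (frob-1 P))
  ^-N^j≈frob (suc j) = begin
    P ^ᴸ (N * N ^ j)         ≈⟨ ^-* P N (N ^ j) ⟩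
    (P ^ᴸ N) ^ᴸ (N ^ j)      ≈⟨ ^-cong (N ^ j) P^N≈frob ⟩
    frob N P ^ᴸ (N ^ j)      ≈⟨ frob-^ N P (N ^ j) ⟨
    frob N (P ^ᴸ (N ^ j))    ≈⟨ frob-cong N (^-N^j≈frob j) ⟩
    frob N (frob (N ^ j) P)  ≈⟨ frob-frob N (N ^ j) P ⟩
    frob (N * N ^ j) P       ∎
    where open ≈-Reasoning m

  ^-N^j*k≈frob : ∀ j k → P ^ᴸ (N ^ j * k) ≈ frob (N ^ j) (P ^ᴸ k) [mod m ]
  ^-N^j*k≈frob j k = begin
    P ^ᴸ (N ^ j * k)           ≈⟨ ^-* P (N ^ j) k ⟩
    (P ^ᴸ (N ^ j)) ^ᴸ k        ≈⟨ ^-cong k (^-N^j≈frob j) ⟩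
    frob (N ^ j) P ^ᴸ k        ≈⟨ frob-^ (N ^ j) P k ⟨
    frob (N ^ j) (P ^ᴸ k)      ∎
    where open ≈-Reasoning m

-- Supports

BoundedBy : ∀ {r} → ℕ → LPoly r → Set
BoundedBy B = All (λ t → ‖ proj₁ t ‖ ≤ B)

boundedBy-mono : ∀ {r B B′} {P : LPoly r} → B ≤ B′ → BoundedBy B P → BoundedBy B′ P
boundedBy-mono B≤B′ = All.map (λ ‖e‖≤B → ℕₚ.≤-trans ‖e‖≤B B≤B′)

boundedBy-exists : ∀ {r} (P : LPoly r) → ∃ λ B → BoundedBy B P
boundedBy-exists [] = 0 , []
boundedBy-exists ((e , c) ∷ P) with boundedBy-exists P
... | B , P≤B = (‖ e ‖ + B) , ℕₚ.m≤m+n (‖ e ‖) B ∷ boundedBy-mono (ℕₚ.m≤n+m B (‖ e ‖)) P≤B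

boundedBy-one : ∀ {r} → BoundedBy 0 (one {r})
boundedBy-one {r} = ℕₚ.≤-reflexive (‖𝟘‖≡0 {r}) ∷ []

private
  boundedBy-map-shift : ∀ {r B₁ B₂} (h : Monomial r → Monomial r) (Q : LPoly r) e → ‖ e ‖ ≤ B₁ →
                        BoundedBy B₂ Q → (∀ e′ c′ → proj₁ (h (e′ , c′)) ≡ e ⊕ e′) → BoundedBy (B₁ + B₂) (map h Q)
  boundedBy-map-shift h [] e _ _ _ = []
  boundedBy-map-shift {B₁ = B₁} {B₂} h ((e′ , c′) ∷ Q) e ‖e‖≤B₁ (‖e′‖≤B₂ ∷ Q≤B₂) h≡ =
    subst (λ x → ‖ x ‖ ≤ B₁ + B₂) (sym (h≡ e′ c′)) (ℕₚ.≤-trans (‖x⊕y‖≤‖x‖+‖y‖ e e′) (ℕₚ.+-mono-≤ ‖e‖≤B₁ ‖e′‖≤B₂))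
    ∷ boundedBy-map-shift h Q e ‖e‖≤B₁ Q≤B₂ h≡

  boundedBy-map-scale : ∀ {r B} (h : Monomial r → Monomial r) N (Q : LPoly r) → BoundedBy B Q →
                        (∀ e′ c′ → proj₁ (h (e′ , c′)) ≡ scale N e′) → BoundedBy (N * B) (map h Q)
  boundedBy-map-scale h N [] _ _ = []
  boundedBy-map-scale {B = B} h N ((e′ , c′) ∷ Q) (‖e′‖≤B ∷ Q≤B) h≡ =
    subst (λ x → ‖ x ‖ ≤ N * B) (sym (h≡ e′ c′)) (subst (_≤ N * B) (sym (‖scale‖ N e′)) (ℕₚ.*-monoʳ-≤ N ‖e′‖≤B))
    ∷ boundedBy-map-scale h N Q Q≤B h≡

boundedBy-· : ∀ {r B₁ B₂} (P Q : LPoly r) → BoundedBy B₁ P → BoundedBy B₂ Q → BoundedBy (B₁ + B₂) (P · Q)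
boundedBy-· [] Q _ _ = []
boundedBy-· ((e , c) ∷ P) Q (‖e‖≤B₁ ∷ P≤B₁) Q≤B₂ =
  All.++⁺ (boundedBy-map-shift _ Q e ‖e‖≤B₁ Q≤B₂ (λ _ _ → refl)) (boundedBy-· P Q P≤B₁ Q≤B₂)

boundedBy-^ : ∀ {r B} (P : LPoly r) n → BoundedBy B P → BoundedBy (n * B) (P ^ᴸ n)
boundedBy-^ P zero _ = boundedBy-one
boundedBy-^ P (suc n) P≤B = boundedBy-· P (P ^ᴸ n) P≤B (boundedBy-^ P n P≤B)

boundedBy-frob : ∀ {r B} N (P : LPoly r) → BoundedBy B P → BoundedBy (N * B) (frob N P)
boundedBy-frob N P P≤B = boundedBy-map-scale _ N P P≤B (λ _ _ → refl)

-- Every exponent of frob N X other than 𝟘 has norm ≥ N, so it cannot cancel against an exponent of S.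
ct-frob-· : ∀ {r B} N (X S : LPoly r) → BoundedBy B S → B < N → ct (frob N X · S) ≡ ct X ℤ.* ct S
ct-frob-· N X S S≤B B<N = begin
  ct (frob N X · S)                                         ≡⟨ coeff-·-pair (frob N X) S 𝟘 ⟩
  pair (frob N X) (λ x → pair S (λ y → δ 𝟘 (x ⊕ y)))        ≡⟨ pair-frob N X _ ⟩
  pair X (λ u → pair S (λ y → δ 𝟘 (scale N u ⊕ y)))         ≡⟨ pair-cong X (λ u → pair-cong-on S S≤B (λ y ‖y‖≤B →
                                                                 δ𝟘-scale⊕small N u y (ℕₚ.≤-<-trans ‖y‖≤B B<N))) ⟩
  pair X (λ u → pair S (λ y → δ 𝟘 u ℤ.* δ 𝟘 y))             ≡⟨ pair-cong X (λ u → pair-*ˡ S (δ 𝟘 u) (δ 𝟘)) ⟩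
  pair X (λ u → δ 𝟘 u ℤ.* pair S (δ 𝟘))                     ≡⟨ pair-*ʳ X (pair S (δ 𝟘)) (δ 𝟘) ⟩
  pair X (δ 𝟘) ℤ.* pair S (δ 𝟘)                             ≡⟨ cong₂ ℤ._*_ (coeff≡pair-δ X 𝟘) (coeff≡pair-δ S 𝟘) ⟨
  ct X ℤ.* ct S                                             ∎
  where open ≡-Reasoning

-- Digits and density

bit : Bool → ℕ
bit true = 1
bit false = 0

count : (ℕ → Bool) → ℕ → ℕ
count g zero = 0
count g (suc N) = bit (g 0) + count (g ∘ suc) N

count-cong : ∀ N {g h : ℕ → Bool} → (∀ n → n < N → g n ≡ h n) → count g N ≡ count h N
count-cong zero g≗h = refl
count-cong (suc N) g≗h = cong₂ _+_ (cong bit (g≗h 0 (s≤s z≤n))) (count-cong N (λ n n<N → g≗h (suc n) (s≤s n<N)))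

count-+ : ∀ x y (g : ℕ → Bool) → count g (x + y) ≡ count g x + count (λ n → g (x + n)) y
count-+ zero y g = refl
count-+ (suc x) y g = trans (cong (λ X → bit (g 0) + X) (count-+ x y (g ∘ suc))) (sym (ℕₚ.+-assoc (bit (g 0)) _ _))

count-mono : ∀ {x y} (g : ℕ → Bool) → x ≤ y → count g x ≤ count g y
count-mono {x} {y} g x≤y = begin
  count g x                                       ≤⟨ ℕₚ.m≤m+n _ _ ⟩
  count g x + count (λ n → g (x + n)) (y ∸ x)     ≡⟨ count-+ x (y ∸ x) g ⟨
  count g (x + (y ∸ x))                           ≡⟨ cong (count g) (ℕₚ.m+[n∸m]≡n x≤y) ⟩
  count g y                                       ∎
  where open ℕₚ.≤-Reasoning

count-∧ : ∀ N (g : ℕ → Bool) c → count (λ n → g n ∧ c) N ≡ count g N * bit c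
count-∧ zero g c = refl
count-∧ (suc N) g c = trans (cong₂ _+_ (bit-∧ (g 0) c) (count-∧ N (g ∘ suc) c)) (sym (ℕₚ.*-distribʳ-+ (bit c) (bit (g 0)) _))
  where
  bit-∧ : ∀ x c → bit (x ∧ c) ≡ bit x * bit c
  bit-∧ true true = refl
  bit-∧ true false = refl
  bit-∧ false c = refl

count+count-not : ∀ N (g : ℕ → Bool) → count g N + count (not ∘ g) N ≡ N
count+count-not zero g = refl
count+count-not (suc N) g = trans (lemma (g 0) _ _) (cong suc (count+count-not N (g ∘ suc)))
  where
  lemma : ∀ x A B → (bit x + A) + (bit (not x) + B) ≡ suc (A + B)
  lemma true A B = refl
  lemma false A B = ℕₚ.+-suc A B

count-≡ᵇ : ∀ N d → d < N → count (_≡ᵇ d) N ≡ 1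
count-≡ᵇ (suc N) zero _ = cong suc (count-false N)
  where
  count-false : ∀ N → count (λ n → suc n ≡ᵇ 0) N ≡ 0
  count-false zero = refl
  count-false (suc N) = count-false N
count-≡ᵇ (suc N) (suc d) (s≤s d<N) = count-≡ᵇ N d d<N

count-≢ᵇ : ∀ N d → d < N → count (not ∘ (_≡ᵇ d)) N ≡ N ∸ 1
count-≢ᵇ N d d<N = sym (trans (cong (_∸ 1) (sym (count+count-not N (_≡ᵇ d))))
                               (cong (λ c → c + count (not ∘ (_≡ᵇ d)) N ∸ 1) (count-≡ᵇ N d d<N)))

length-filter≤count : ∀ {ℓ} {B : Pred ℕ ℓ} (B? : Decidable B) N (f : ℕ → ℕ) (g : ℕ → Bool) →
                      (∀ n → B (f n) → g n ≡ true) → length (filter B? (applyUpTo f N)) ≤ count g N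
length-filter≤count B? zero f g B⇒g = z≤n
length-filter≤count B? (suc N) f g B⇒g with B? (f 0)
... | yes Bf0 rewrite B⇒g 0 Bf0 = s≤s (length-filter≤count B? N (f ∘ suc) (g ∘ suc) (B⇒g ∘ suc))
... | no _ = ℕₚ.≤-trans (length-filter≤count B? N (f ∘ suc) (g ∘ suc) (B⇒g ∘ suc)) (ℕₚ.m≤n+m _ (bit (g 0)))

module BaseDigits (b d : ℕ) .{{_ : NonZero b}} (d<b : d < b) where

  avoids : ℕ → ℕ → Bool
  avoids zero n = true
  avoids (suc M) n = not (n % b ≡ᵇ d) ∧ avoids M (n / b)

  private
    divMod-unique : ∀ r q → r < b → ((r + q * b) % b ≡ r) × ((r + q * b) / b ≡ q)
    divMod-unique r q r<b = mod≡r , div≡q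
      where
      mod≡r = trans ([m+kn]%n≡m%n r q b) (m<n⇒m%n≡m r<b)
      div≡q = sym (ℕₚ.*-cancelʳ-≡ q ((r + q * b) / b) b
                (ℕₚ.+-cancelˡ-≡ r _ _ (trans (m≡m%n+[m/n]*n (r + q * b) b) (cong (_+ ((r + q * b) / b * b)) mod≡r))))

  avoids-suc : ∀ M q r → r < b → avoids (suc M) (r + q * b) ≡ (not (r ≡ᵇ d) ∧ avoids M q)
  avoids-suc M q r r<b rewrite proj₁ (divMod-unique r q r<b) | proj₂ (divMod-unique r q r<b) = refl

  count-blocks : ∀ X (f g h : ℕ → Bool) → (∀ q r → r < b → f (r + q * b) ≡ (g r ∧ h q)) →
                 count f (X * b) ≡ count h X * count g b
  count-blocks zero f g h _ = refl
  count-blocks (suc X) f g h f≡ = begin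
    count f (b + X * b)                                            ≡⟨ count-+ b (X * b) f ⟩
    count f b + count (λ n → f (b + n)) (X * b)                    ≡⟨ cong₂ _+_ first-block other-blocks ⟩
    count g b * bit (h 0) + count (h ∘ suc) X * count g b          ≡⟨ lemma (count g b) (bit (h 0)) (count (h ∘ suc) X) ⟩
    (bit (h 0) + count (h ∘ suc) X) * count g b                    ∎
    where
    open ≡-Reasoning
    first-block : count f b ≡ count g b * bit (h 0)
    first-block = trans (count-cong b (λ r r<b → trans (cong f (sym (ℕₚ.+-identityʳ r))) (f≡ 0 r r<b))) (count-∧ b g (h 0))
    other-blocks : count (λ n → f (b + n)) (X * b) ≡ count (h ∘ suc) X * count g b
    other-blocks = count-blocks X (λ n → f (b + n)) g (h ∘ suc) (λ q r r<b → trans (cong f (shift r q)) (f≡ (suc q) r r<b))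
      where
      shift : ∀ r q → b + (r + q * b) ≡ r + suc q * b
      shift r q = shift′ b r q
        where
        shift′ : ∀ b r q → b + (r + q * b) ≡ r + (b + q * b)
        shift′ = ℕ-solver.solve-∀
    lemma : ∀ G h₀ H → G * h₀ + H * G ≡ (h₀ + H) * G
    lemma = ℕ-solver.solve-∀

  count-avoids : ∀ M → count (avoids M) (b ^ M) ≡ (b ∸ 1) ^ M
  count-avoids zero = refl
  count-avoids (suc M) = begin
    count (avoids (suc M)) (b * b ^ M)                   ≡⟨ cong (count (avoids (suc M))) (ℕₚ.*-comm b (b ^ M)) ⟩
    count (avoids (suc M)) (b ^ M * b)                   ≡⟨ count-blocks (b ^ M) (avoids (suc M)) (not ∘ (_≡ᵇ d)) (avoids M) (avoids-suc M) ⟩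
    count (avoids M) (b ^ M) * count (not ∘ (_≡ᵇ d)) b   ≡⟨ cong₂ _*_ (count-avoids M) (count-≢ᵇ b d d<b) ⟩
    (b ∸ 1) ^ M * (b ∸ 1)                                ≡⟨ ℕₚ.*-comm ((b ∸ 1) ^ M) (b ∸ 1) ⟩
    (b ∸ 1) ^ suc M                                      ∎
    where open ≡-Reasoning

  ¬avoids⇒digit : ∀ M n → avoids M n ≡ false → ∃ λ j → ∃ λ m → ∃ λ t → t < b ^ j × n ≡ b ^ j * (b * m + d) + t
  ¬avoids⇒digit zero n ()
  ¬avoids⇒digit (suc M) n ¬avoids with n % b ≡ᵇ d in n%b≡ᵇd
  ... | true = 0 , n / b , 0 , s≤s z≤n , (begin
    n                          ≡⟨ m≡m%n+[m/n]*n n b ⟩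
    n % b + n / b * b          ≡⟨ cong (_+ n / b * b) (ℕₚ.≡ᵇ⇒≡ (n % b) d (subst T (sym n%b≡ᵇd) _)) ⟩
    d + n / b * b              ≡⟨ lemma d (n / b) b ⟩
    1 * (b * (n / b) + d) + 0  ∎)
    where
    open ≡-Reasoning
    lemma : ∀ d q b → d + q * b ≡ 1 * (b * q + d) + 0
    lemma = ℕ-solver.solve-∀
  ... | false with ¬avoids⇒digit M (n / b) ¬avoids
  ... | j , m , t , t<bʲ , n/b≡ = suc j , m , t * b + n % b , t′<bʲ⁺¹ , (begin
    n                                          ≡⟨ m≡m%n+[m/n]*n n b ⟩
    n % b + n / b * b                          ≡⟨ cong (λ q → n % b + q * b) n/b≡ ⟩
    n % b + (b ^ j * (b * m + d) + t) * b      ≡⟨ lemma (n % b) (b ^ j) b m d t ⟩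
    b * b ^ j * (b * m + d) + (t * b + n % b)  ∎)
    where
    open ≡-Reasoning
    lemma : ∀ r B b m d t → r + (B * (b * m + d) + t) * b ≡ b * B * (b * m + d) + (t * b + r)
    lemma = ℕ-solver.solve-∀
    t′<bʲ⁺¹ : t * b + n % b < b * b ^ j
    t′<bʲ⁺¹ = ℕₚ.<-≤-trans (ℕₚ.+-monoʳ-< (t * b) (m%n<n n b))
                (subst₂ _≤_ (ℕₚ.+-comm b (t * b)) (ℕₚ.*-comm (b ^ j) b) (ℕₚ.*-monoˡ-≤ b t<bʲ))

-- Bernoulli's inequality (1 + 1/x)^M ≥ 1 + M/x, cleared of denominators.
bernoulli : ∀ x M → x ^ M * (x + M) ≤ x * suc x ^ M
bernoulli x zero = ℕₚ.≤-reflexive (lemma x)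
  where
  lemma : ∀ x → 1 * (x + 0) ≡ x * 1
  lemma = ℕ-solver.solve-∀
bernoulli x (suc M) = begin
  x * x ^ M * (x + suc M)           ≡⟨ expand x (x ^ M) M ⟩
  x * (x ^ M * (x + M) + x ^ M)     ≤⟨ ℕₚ.*-monoʳ-≤ x (ℕₚ.+-mono-≤ (bernoulli x M) (ℕₚ.^-monoˡ-≤ M (ℕₚ.n≤1+n x))) ⟩
  x * (x * suc x ^ M + suc x ^ M)   ≡⟨ cong (x *_) (ℕₚ.+-comm (x * suc x ^ M) (suc x ^ M)) ⟩
  x * suc x ^ suc M                 ∎
  where
  open ℕₚ.≤-Reasoning
  expand : ∀ x X M → x * X * (x + suc M) ≡ x * (X * (x + M) + X)
  expand = ℕ-solver.solve-∀

k*x^[1+M]≤[1+x]^M : ∀ x k M → 1 ≤ x → k * x * x ≤ M → k * x ^ suc M ≤ suc x ^ M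
k*x^[1+M]≤[1+x]^M x k M 1≤x kx²≤M = ℕₚ.*-cancelˡ-≤ (x * x) {{x²≢0}} (begin
  x * x * (k * x ^ suc M)    ≡⟨ lemma x (x ^ M) k ⟩
  x * x ^ M * (k * x * x)    ≤⟨ ℕₚ.*-monoʳ-≤ (x * x ^ M) kx²≤M ⟩
  x * x ^ M * M              ≡⟨ ℕₚ.*-assoc x (x ^ M) M ⟩
  x * (x ^ M * M)            ≤⟨ ℕₚ.*-monoʳ-≤ x (ℕₚ.≤-trans (ℕₚ.*-monoʳ-≤ (x ^ M) (ℕₚ.m≤n+m M x)) (bernoulli x M)) ⟩
  x * (x * suc x ^ M)        ≡⟨ ℕₚ.*-assoc x x (suc x ^ M) ⟨
  x * x * suc x ^ M          ∎)
  where
  open ℕₚ.≤-Reasoning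
  x²≢0 : NonZero (x * x)
  x²≢0 = ℕ.>-nonZero (ℕₚ.*-mono-≤ 1≤x 1≤x)
  lemma : ∀ x X k → x * x * (k * (x * X)) ≡ x * X * (k * x * x)
  lemma = ℕ-solver.solve-∀

between-powers : ∀ b → 2 ≤ b → ∀ N → 1 ≤ N → ∃ λ M → b ^ M ≤ N × N < b ^ suc M
between-powers b 2≤b (suc zero) _ = 0 , ℕₚ.≤-refl , subst (1 <_) (sym (ℕₚ.*-identityʳ b)) 2≤b
between-powers b 2≤b (suc (suc n)) _ with between-powers b 2≤b (suc n) (s≤s z≤n)
... | M , bᴹ≤ , <bᴹ⁺¹ with suc (suc n) ℕₚ.<? b ^ suc M
...   | yes <bᴹ⁺¹′ = M , ℕₚ.≤-trans bᴹ≤ (ℕₚ.n≤1+n _) , <bᴹ⁺¹′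
...   | no ≮bᴹ⁺¹ = suc M , ℕₚ.≤-reflexive (sym n≡bᴹ⁺¹) , subst (_< b ^ suc (suc M)) (sym n≡bᴹ⁺¹) bᴹ⁺¹<bᴹ⁺²
  where
  instance
    bᴹ⁺¹≢0 : NonZero (b ^ suc M)
    bᴹ⁺¹≢0 = ℕ.>-nonZero (ℕₚ.<-≤-trans (s≤s z≤n) <bᴹ⁺¹)
  n≡bᴹ⁺¹ : suc (suc n) ≡ b ^ suc M
  n≡bᴹ⁺¹ = ℕₚ.≤-antisym <bᴹ⁺¹ (ℕₚ.≮⇒≥ ≮bᴹ⁺¹)
  bᴹ⁺¹<bᴹ⁺² : b ^ suc M < b ^ suc (suc M)
  bᴹ⁺¹<bᴹ⁺² = subst (b ^ suc M <_) (ℕₚ.*-comm (b ^ suc M) b) (ℕₚ.m<m*n (b ^ suc M) b 2≤b)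

-- Almost every number has the digit d somewhere in base b: those avoiding it below b^M number (b-1)^M.
digit-density : ∀ b d → 2 ≤ b → d < b → ∀ {ℓ} {B : Pred ℕ ℓ} (B? : Decidable B) →
                (∀ j m t → t < b ^ j → ¬ B (b ^ j * (b * m + d) + t)) →
                ∀ k → ∃ λ N₀ → ∀ N → N₀ ≤ N → k * length (filter B? (upTo N)) ≤ N
digit-density b d 2≤b d<b {B = B} B? no-digit k = b ^ M₀ , sparse
  where
  instance
    b≢0 : NonZero b
    b≢0 = ℕ.>-nonZero (ℕₚ.≤-trans (s≤s z≤n) 2≤b)
  open BaseDigits b d d<b
  x = b ∸ 1
  1+x≡b : suc x ≡ b
  1+x≡b = ℕₚ.m+[n∸m]≡n (ℕₚ.≤-trans (s≤s z≤n) 2≤b)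
  M₀ = k * x * x
  sparse : ∀ N → b ^ M₀ ≤ N → k * length (filter B? (upTo N)) ≤ N
  sparse N bᴹ⁰≤N with between-powers b 2≤b N (ℕₚ.≤-trans (ℕₚ.^-monoʳ-≤ b {0} {M₀} z≤n) bᴹ⁰≤N)
  ... | M , bᴹ≤N , N<bᴹ⁺¹ = begin
    k * length (filter B? (upTo N))   ≤⟨ ℕₚ.*-monoʳ-≤ k few-in-B ⟩
    k * x ^ suc M                     ≤⟨ subst (λ b → k * x ^ suc M ≤ b ^ M) 1+x≡b (k*x^[1+M]≤[1+x]^M x k M 1≤x M₀≤M) ⟩
    b ^ M                             ≤⟨ bᴹ≤N ⟩
    N                                 ∎
    where
    open ℕₚ.≤-Reasoning
    1≤x : 1 ≤ x
    1≤x = ℕₚ.∸-monoˡ-≤ 1 2≤b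
    M₀≤M : M₀ ≤ M
    M₀≤M = ℕₚ.≮⇒≥ (λ M<M₀ → ℕₚ.<⇒≱ N<bᴹ⁺¹ (ℕₚ.≤-trans (ℕₚ.^-monoʳ-≤ b M<M₀) bᴹ⁰≤N))
    B⇒avoids : ∀ n → B n → avoids (suc M) n ≡ true
    B⇒avoids n Bn with avoids (suc M) n in avoids≡
    ... | true = refl
    ... | false with ¬avoids⇒digit (suc M) n avoids≡
    ...   | j , m , t , t<bʲ , refl = ⊥-elim (no-digit j m t t<bʲ Bn)
    few-in-B : length (filter B? (upTo N)) ≤ x ^ suc M
    few-in-B = begin
      length (filter B? (upTo N))        ≤⟨ length-filter≤count B? N (λ n → n) (avoids (suc M)) B⇒avoids ⟩
      count (avoids (suc M)) N           ≤⟨ count-mono (avoids (suc M)) (ℕₚ.<⇒≤ N<bᴹ⁺¹) ⟩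
      count (avoids (suc M)) (b ^ suc M) ≡⟨ count-avoids (suc M) ⟩
      x ^ suc M                          ∎

repdigit : ℕ → ℕ → ℕ → ℕ
repdigit b d zero = 0
repdigit b d (suc k) = b * repdigit b d k + d

repdigit<b^k : ∀ {b d} → d < b → ∀ k → repdigit b d k < b ^ k
repdigit<b^k d<b zero = s≤s z≤n
repdigit<b^k {b} {d} d<b (suc k) = begin-strict
  b * R + d        <⟨ ℕₚ.+-monoʳ-< (b * R) d<b ⟩
  b * R + b        ≡⟨ trans (ℕₚ.+-comm (b * R) b) (sym (ℕₚ.*-suc b R)) ⟩
  b * suc R        ≤⟨ ℕₚ.*-monoʳ-≤ b (repdigit<b^k d<b k) ⟩
  b * b ^ k        ∎
  where
  open ℕₚ.≤-Reasoning
  R = repdigit b d k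

n<m^n : ∀ m → 2 ≤ m → ∀ n → n < m ^ n
n<m^n m 2≤m zero = s≤s z≤n
n<m^n m 2≤m (suc n) = begin-strict
  suc n      ≤⟨ n<m^n m 2≤m n ⟩
  m ^ n      <⟨ ℕₚ.m<m*n (m ^ n) m 2≤m ⟩
  m ^ n * m  ≡⟨ ℕₚ.*-comm (m ^ n) m ⟩
  m ^ suc n  ∎
  where
  open ℕₚ.≤-Reasoning
  instance
    mⁿ≢0 : NonZero (m ^ n)
    mⁿ≢0 = ℕₚ.m^n≢0 m n {{ℕ.>-nonZero (ℕₚ.≤-trans (s≤s z≤n) 2≤m)}}

-- Divisibility of constant terms

block-bounds : ∀ {D B n₀ K S t} .{{_ : NonZero S}} → n₀ * D + (D + B) < K → t < S →
               (t * D + B < S * K) × (S * K * (n₀ * D) + (t * D + B) < S * K * K)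
block-bounds {D} {B} {n₀} {K} {S} {t} K-large t<S = inner , outer
  where
  open ℕₚ.≤-Reasoning
  inner : t * D + B < S * K
  inner = begin-strict
    t * D + B        ≤⟨ ℕₚ.+-mono-≤ (ℕₚ.*-monoˡ-≤ D (ℕₚ.<⇒≤ t<S)) (ℕₚ.m≤n*m B S) ⟩
    S * D + S * B    ≡⟨ ℕₚ.*-distribˡ-+ S D B ⟨
    S * (D + B)      <⟨ ℕₚ.*-monoʳ-< S (ℕₚ.≤-<-trans (ℕₚ.m≤n+m (D + B) (n₀ * D)) K-large) ⟩
    S * K            ∎
  outer : S * K * (n₀ * D) + (t * D + B) < S * K * K
  outer = begin-strict
    S * K * (n₀ * D) + (t * D + B)  <⟨ ℕₚ.+-monoʳ-< (S * K * (n₀ * D)) inner ⟩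
    S * K * (n₀ * D) + S * K        ≡⟨ trans (ℕₚ.+-comm _ (S * K)) (sym (ℕₚ.*-suc (S * K) (n₀ * D))) ⟩
    S * K * suc (n₀ * D)            ≤⟨ ℕₚ.*-monoʳ-≤ (S * K) (ℕₚ.≤-<-trans (ℕₚ.m≤m+n (n₀ * D) (D + B)) K-large) ⟩
    S * K * K                       ∎

module _ {r M p} .{{_ : NonZero p}} {P : LPoly r} (P^p≈frob : P ^ᴸ p ≈ frob p P [mod M ]) where

  ct-^-split : ∀ {D B} j₁ j₂ m n t (Q : LPoly r) → BoundedBy D (P ^ᴸ n) → BoundedBy B ((P ^ᴸ t) · Q) →
               B < p ^ j₂ → p ^ j₂ * D + B < p ^ j₁ →
               + M ∣ₛ ct ((P ^ᴸ (p ^ j₁ * m + p ^ j₂ * n + t)) · Q) ℤ.- ct (P ^ᴸ m) ℤ.* (ct (P ^ᴸ n) ℤ.* ct ((P ^ᴸ t) · Q))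
  ct-^-split j₁ j₂ m n t Q Pⁿ≤D S≤B B<N₂ N₂D+B<N₁ =
    ∣ₛ-subst (cong (λ X → ct ((P ^ᴸ (N₁ * m + N₂ * n + t)) · Q) ℤ.- X) ct-factors) (coeff-∣ to-frobenius 𝟘)
    where
    N₁ = p ^ j₁
    N₂ = p ^ j₂
    S = (P ^ᴸ t) · Q
    to-frobenius : (P ^ᴸ (N₁ * m + N₂ * n + t)) · Q ≈ frob N₁ (P ^ᴸ m) · (frob N₂ (P ^ᴸ n) · S) [mod M ]
    to-frobenius = begin
      (P ^ᴸ (N₁ * m + N₂ * n + t)) · Q            ≈⟨ ·-congʳ Q (^-+ P (N₁ * m + N₂ * n) t) ⟩
      ((P ^ᴸ (N₁ * m + N₂ * n)) · (P ^ᴸ t)) · Q   ≈⟨ ·-assoc (P ^ᴸ (N₁ * m + N₂ * n)) (P ^ᴸ t) Q ⟩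
      (P ^ᴸ (N₁ * m + N₂ * n)) · S                ≈⟨ ·-congʳ S (^-+ P (N₁ * m) (N₂ * n)) ⟩
      ((P ^ᴸ (N₁ * m)) · (P ^ᴸ (N₂ * n))) · S     ≈⟨ ·-assoc (P ^ᴸ (N₁ * m)) (P ^ᴸ (N₂ * n)) S ⟩
      (P ^ᴸ (N₁ * m)) · ((P ^ᴸ (N₂ * n)) · S)     ≈⟨ ·-cong (^-N^j*k≈frob P^p≈frob j₁ m) (·-congʳ S (^-N^j*k≈frob P^p≈frob j₂ n)) ⟩
      frob N₁ (P ^ᴸ m) · (frob N₂ (P ^ᴸ n) · S)   ∎
      where open ≈-Reasoning M
    ct-factors : ct (frob N₁ (P ^ᴸ m) · (frob N₂ (P ^ᴸ n) · S)) ≡ ct (P ^ᴸ m) ℤ.* (ct (P ^ᴸ n) ℤ.* ct S)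
    ct-factors = trans
      (ct-frob-· N₁ (P ^ᴸ m) _ (boundedBy-· (frob N₂ (P ^ᴸ n)) S (boundedBy-frob N₂ (P ^ᴸ n) Pⁿ≤D) S≤B) N₂D+B<N₁)
      (cong (ct (P ^ᴸ m) ℤ.*_) (ct-frob-· N₂ (P ^ᴸ n) S S≤B B<N₂))

  module _ {n₀ D B c} (p∣ct : + p ∣ₛ ct (P ^ᴸ n₀)) (P≤D : BoundedBy D P) (pᶜ-large : n₀ * D + (D + B) < p ^ c) where

    K base digit : ℕ
    K = p ^ c
    base = K * K
    digit = K * n₀

    ct-^-digit-split : ∀ x m t (Q : LPoly r) → BoundedBy B Q → t < p ^ x →
                       + M ∣ₛ ct ((P ^ᴸ (p ^ x * (base * m + digit) + t)) · Q) ℤ.- ct (P ^ᴸ m) ℤ.* (ct (P ^ᴸ n₀) ℤ.* ct ((P ^ᴸ t) · Q))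
    ct-^-digit-split x m t Q Q≤B t<pˣ =
      subst (λ n → + M ∣ₛ ct ((P ^ᴸ n) · Q) ℤ.- ct (P ^ᴸ m) ℤ.* (ct (P ^ᴸ n₀) ℤ.* ct ((P ^ᴸ t) · Q))) index
        (ct-^-split (x + c + c) (x + c) m n₀ t Q (boundedBy-^ P n₀ P≤D) (boundedBy-· (P ^ᴸ t) Q (boundedBy-^ P t P≤D) Q≤B)
          (subst (t * D + B <_) (sym pˣ⁺ᶜ) (proj₁ bounds))
          (subst₂ (λ N₂ N₁ → N₂ * (n₀ * D) + (t * D + B) < N₁) (sym pˣ⁺ᶜ) (sym pˣ⁺ᶜ⁺ᶜ) (proj₂ bounds)))
      where
      S = p ^ x
      instance
        S≢0 : NonZero S
        S≢0 = ℕₚ.m^n≢0 p x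
      bounds = block-bounds {n₀ = n₀} {S = S} pᶜ-large t<pˣ
      pˣ⁺ᶜ : p ^ (x + c) ≡ S * K
      pˣ⁺ᶜ = ℕₚ.^-distribˡ-+-* p x c
      pˣ⁺ᶜ⁺ᶜ : p ^ (x + c + c) ≡ S * K * K
      pˣ⁺ᶜ⁺ᶜ = trans (ℕₚ.^-distribˡ-+-* p (x + c) c) (cong (_* K) pˣ⁺ᶜ)
      index : p ^ (x + c + c) * m + p ^ (x + c) * n₀ + t ≡ S * (base * m + digit) + t
      index = trans (cong₂ (λ N₁ N₂ → N₁ * m + N₂ * n₀ + t) pˣ⁺ᶜ⁺ᶜ pˣ⁺ᶜ) (distrib S K m n₀ t)
        where
        distrib : ∀ S K m n₀ t → S * K * K * m + S * K * n₀ + t ≡ S * (K * K * m + K * n₀) + t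
        distrib = ℕ-solver.solve-∀

    -- Appending the digit to m (with t below it) gains a factor p, as long as the modulus allows it.
    ct-^-digit-∣ : ∀ {u} x m t (Q : LPoly r) → BoundedBy B Q → t < p ^ x → + u ∣ₛ ct (P ^ᴸ m) → p * u ∣ℕ M →
                   + (p * u) ∣ₛ ct ((P ^ᴸ (p ^ x * (base * m + digit) + t)) · Q)
    ct-^-digit-∣ {u} x m t Q Q≤B t<pˣ u∣ct pu∣M =
      ∣ₛ-subst (lemma X Y) (Signed.∣m∣n⇒∣m+n (Signed.∣-trans (Signed.∣ᵤ⇒∣ pu∣M) (ct-^-digit-split x m t Q Q≤B t<pˣ)) pu∣Y)
      where
      X = ct ((P ^ᴸ (p ^ x * (base * m + digit) + t)) · Q)
      Y = ct (P ^ᴸ m) ℤ.* (ct (P ^ᴸ n₀) ℤ.* ct ((P ^ᴸ t) · Q))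
      pu∣Y : + (p * u) ∣ₛ Y
      pu∣Y = subst (_∣ₛ Y) (trans (ℤₚ.*-comm (+ u) (+ p)) (sym (ℤₚ.pos-* p u))) (∣ₛ-* u∣ct (Signed.∣m⇒∣m*n _ p∣ct))
      lemma : ∀ X Y → (X ℤ.- Y) ℤ.+ Y ≡ X
      lemma = solve-∀

    ct-^-repdigit-∣ : ∀ k m → p ^ k ∣ℕ M → + (p ^ k) ∣ₛ ct (P ^ᴸ (base ^ k * m + repdigit base digit k))
    ct-^-repdigit-∣ zero m _ = 1∣ₛ _
    ct-^-repdigit-∣ (suc k) m pᵏ⁺¹∣M =
      ≈⇒ct-∣ (·-identityʳ (P ^ᴸ n)) (subst (λ n → + (p ^ suc k) ∣ₛ ct ((P ^ᴸ n) · one)) index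
        (ct-^-digit-∣ 0 m′ 0 one (boundedBy-mono z≤n boundedBy-one) (s≤s z≤n)
          (ct-^-repdigit-∣ k m (ℕ-∣.m*n∣⇒n∣ p (p ^ k) pᵏ⁺¹∣M)) pᵏ⁺¹∣M))
      where
      m′ = base ^ k * m + repdigit base digit k
      n = base ^ suc k * m + repdigit base digit (suc k)
      index : 1 * (base * m′ + digit) + 0 ≡ n
      index = lemma base (base ^ k) m (repdigit base digit k) digit
        where
        lemma : ∀ b bᵏ m R d → 1 * (b * (bᵏ * m + R) + d) + 0 ≡ b * bᵏ * m + (b * R + d)
        lemma = ℕ-solver.solve-∀

    ct-^-block-∣ : ∀ k x m t (Q : LPoly r) → BoundedBy B Q → t < p ^ x → p ^ suc k ∣ℕ M →
                   + (p ^ suc k) ∣ₛ ct ((P ^ᴸ (p ^ x * (base ^ suc k * m + repdigit base digit (suc k)) + t)) · Q)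
    ct-^-block-∣ k x m t Q Q≤B t<pˣ pᵏ⁺¹∣M =
      subst (λ n → + (p ^ suc k) ∣ₛ ct ((P ^ᴸ n) · Q)) index
        (ct-^-digit-∣ x m′ t Q Q≤B t<pˣ (ct-^-repdigit-∣ k m (ℕ-∣.m*n∣⇒n∣ p (p ^ k) pᵏ⁺¹∣M)) pᵏ⁺¹∣M)
      where
      m′ = base ^ k * m + repdigit base digit k
      index : p ^ x * (base * m′ + digit) + t ≡ p ^ x * (base ^ suc k * m + repdigit base digit (suc k)) + t
      index = lemma (p ^ x) base (base ^ k) m (repdigit base digit k) digit t
        where
        lemma : ∀ S b bᵏ m R d t → S * (b * (bᵏ * m + R) + d) + t ≡ S * (b * bᵏ * m + (b * R + d)) + t
        lemma = ℕ-solver.solve-∀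

    ct-^-zero-density : ∀ k (Q : LPoly r) → BoundedBy B Q → 1 < p ^ c → n₀ < p ^ c → p ^ suc k ∣ℕ M →
                        ZeroFreqOne (p ^ suc k) (λ n → ct ((P ^ᴸ n) · Q))
    ct-^-zero-density k Q Q≤B 1<pᶜ n₀<pᶜ pᵏ⁺¹∣M =
      digit-density b d 2≤b d<b (λ n → ¬? (p ^ suc k ∣ℕ? ℤ.∣ ct ((P ^ᴸ n) · Q) ∣)) divisible-at-digit
      where
      instance
        K≢0 : NonZero K
        K≢0 = ℕₚ.m^n≢0 p c
        baseᵏ≢0 : NonZero (base ^ k)
        baseᵏ≢0 = ℕₚ.m^n≢0 base k {{ℕₚ.m*n≢0 K K}}
      b = base ^ suc k
      d = repdigit base digit (suc k)
      d<b : d < b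
      d<b = repdigit<b^k (ℕₚ.*-monoʳ-< K n₀<pᶜ) (suc k)
      2≤b : 2 ≤ b
      2≤b = ℕₚ.≤-trans 1<pᶜ (ℕₚ.≤-trans (ℕₚ.m≤m*n K K) (ℕₚ.m≤m*n base (base ^ k)))
      bʲ≡pˣ : ∀ j → b ^ j ≡ p ^ ((c + c) * suc k * j)
      bʲ≡pˣ j = trans (cong (λ β → (β ^ suc k) ^ j) (sym (ℕₚ.^-distribˡ-+-* p c c)))
                  (trans (cong (_^ j) (ℕₚ.^-*-assoc p (c + c) (suc k))) (ℕₚ.^-*-assoc p ((c + c) * suc k) j))
      divisible-at-digit : ∀ j m t → t < b ^ j → ¬ ¬ (p ^ suc k ∣ℕ ℤ.∣ ct ((P ^ᴸ (b ^ j * (b * m + d) + t)) · Q) ∣)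
      divisible-at-digit j m t t<bʲ ¬div = ¬div (Signed.∣⇒∣ᵤ
        (subst (λ S → + (p ^ suc k) ∣ₛ ct ((P ^ᴸ (S * (b * m + d) + t)) · Q)) (sym (bʲ≡pˣ j))
          (ct-^-block-∣ k ((c + c) * suc k * j) m t Q Q≤B (subst (t <_) (bʲ≡pˣ j) t<bʲ) pᵏ⁺¹∣M)))

lemma31 : (p a r : ℕ) → Prime p → 1 ≤ a → (P : LPoly r)
    → (P ^ᴸ p) ≡[mod p ^ a ] frob p P
    → ∃ (λ n₀ → (+ p) ∣ ct (P ^ᴸ n₀))
    → (Q : LPoly r) → ZeroFreqOne (p ^ a) (λ n → ct ((P ^ᴸ n) · Q))
lemma31 p zero r _ () P _ _ Q
lemma31 p (suc k) r p-prime _ P P^p≡frob (n₀ , p∣ct) Q =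
  ct-^-zero-density P^p≈frob {c = c} (Signed.∣ᵤ⇒∣ p∣ct) P≤D (below-pᶜ (ℕₚ.m≤n⇒m≤1+n (ℕₚ.m≤n+m X n₀))) k Q Q≤B
    (below-pᶜ (s≤s z≤n)) (below-pᶜ (ℕₚ.m≤n⇒m≤1+n (ℕₚ.m≤m+n n₀ X))) ℕ-∣.∣-refl
  where
  instance
    p≢0 : NonZero p
    p≢0 = prime⇒nonZero p-prime
  P^p≈frob : P ^ᴸ p ≈ frob p P [mod p ^ suc k ]
  P^p≈frob = coeffwise λ e → Signed.∣ᵤ⇒∣ (P^p≡frob e)
  D = proj₁ (boundedBy-exists P)
  P≤D = proj₂ (boundedBy-exists P)
  B = proj₁ (boundedBy-exists Q)
  Q≤B = proj₂ (boundedBy-exists Q)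
  X = n₀ * D + (D + B)
  c = suc (n₀ + X)
  below-pᶜ : ∀ {y} → y ≤ c → y < p ^ c
  below-pᶜ y≤c = ℕₚ.≤-<-trans y≤c (n<m^n p (ℕ.nonTrivial⇒n>1 p {{prime⇒nonTrivial p-prime}}) c)
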